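{- Let $A$ be a poset with order $\le$, let $(\cdot,\to)$ be an adjunction on $A$, and let $1\in A$. Then the following are equivalent: (a) $(A,\to,1)$ is a wBCK*-algebra; (b) $(A,\cdot,1)$ is a commutative groupoid in which $1$ is a neutral element and $1$ is also the greatest element of $A$. Moreover, if these conditions hold, then the wBCK*-algebra $(A,\to,1)$ is weakly contractive if and only if the groupoid $(A,\cdot)$ is idempotent (i.e. $x\cdot x=x$ for all $x$).
   Context: An adjunction on a poset $A$ is a pair $(\cdot,\to)$ of binary operations on $A$ such that for all $x,y,z$: $x\le y\to z$ if and only if $x\cdot y\le z$. A wBCK*-algebra is an algebra $(A,\to,1)$ where $A$ is a poset with greatest element $1$, $x\le y$ iff $x\to y=1$, and for all $x,y,z$: if $x\le y\to z$ then $y\le x\to z$. It is weakly contractive if moreover for all $x,y$: if $x\le x\to y$ then $x\le y$. -}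

module Defs where

open import Level using (Level; _⊔_)
open import Data.Product using (_×_)
open import Relation.Binary.Bundles using (Poset)

module _ {c ℓ₁ ℓ₂ : Level} (P : Poset c ℓ₁ ℓ₂) where
  open Poset P renaming (Carrier to A)

  IsAdjunction : (A → A → A) → (A → A → A) → Set (c ⊔ ℓ₂)
  IsAdjunction _·_ _⇒_ = ∀ x y z → ((x ≤ (y ⇒ z)) → ((x · y) ≤ z)) × (((x · y) ≤ z) → (x ≤ (y ⇒ z)))

  IsGreatest : A → Set (c ⊔ ℓ₂)
  IsGreatest one = ∀ x → x ≤ one

  IsWBCK* : (A → A → A) → A → Set (c ⊔ ℓ₁ ⊔ ℓ₂)
  IsWBCK* _⇒_ one =
    IsGreatest one
    × (∀ x y → ((x ≤ y) → (x ⇒ y) ≈ one) × ((x ⇒ y) ≈ one → x ≤ y))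
    × (∀ x y z → x ≤ (y ⇒ z) → y ≤ (x ⇒ z))

  IsWeaklyContractive : (A → A → A) → Set (c ⊔ ℓ₂)
  IsWeaklyContractive _⇒_ = ∀ x y → x ≤ (x ⇒ y) → x ≤ y

  IsCommGroupoidWithNeutral : (A → A → A) → A → Set (c ⊔ ℓ₁)
  IsCommGroupoidWithNeutral _·_ one =
    (∀ x y → (x · y) ≈ (y · x))
    × (∀ x → (one · x) ≈ x × (x · one) ≈ x)

  IsIdempotent : (A → A → A) → Set (c ⊔ ℓ₁)
  IsIdempotent _·_ = ∀ x → (x · x) ≈ x

module Submission where

-- Each axiom of one side corresponds to an axiom of the other through the
-- residuation  x ≤ y ⇒ z ⇔ x · y ≤ z :
--   * the exchange law of ⇒ is equivalent to commutativity of ·;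
--   * when 1 is the top, "x ≤ y iff x ⇒ y = 1" is equivalent to 1 being a
--     left unit of ·;
--   * weak contractivity of ⇒ is equivalent to x ≤ x · x, and when 1 is a
--     left unit and the top, x · x ≤ x always holds ("integrality").

open import Defs
open import Level using (Level)
open import Data.Product using (_×_; _,_; proj₁)
open import Function.Bundles using (_⇔_; mk⇔)
open import Relation.Binary.Bundles using (Poset)
import Relation.Binary.Reasoning.PartialOrder as PosetReasoning

module Adjunction {c ℓ₁ ℓ₂ : Level} (P : Poset c ℓ₁ ℓ₂)
    (_·_ _⇒_ : Poset.Carrier P → Poset.Carrier P → Poset.Carrier P)
    (adj : IsAdjunction P _·_ _⇒_) where
  open Poset P renaming (Carrier to A)
  open PosetReasoning P

  uncurry≤ : ∀ {x y z} → x ≤ (y ⇒ z) → (x · y) ≤ z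
  uncurry≤ {x} {y} {z} with adj x y z
  ... | to , _ = to

  curry≤ : ∀ {x y z} → (x · y) ≤ z → x ≤ (y ⇒ z)
  curry≤ {x} {y} {z} with adj x y z
  ... | _ , from = from

  unit : ∀ x y → x ≤ (y ⇒ (x · y))
  unit x y = curry≤ refl

  ·-monoˡ : ∀ {x x′} y → x ≤ x′ → (x · y) ≤ (x′ · y)
  ·-monoˡ {x′ = x′} y x≤x′ = uncurry≤ (trans x≤x′ (unit x′ y))

  exchange⇒comm : (∀ x y z → x ≤ (y ⇒ z) → y ≤ (x ⇒ z)) →
                  ∀ x y → (x · y) ≈ (y · x)
  exchange⇒comm exch x y = antisym (swap refl) (swap refl)
    where
    swap : ∀ {u v w} → (u · v) ≤ w → (v · u) ≤ w
    swap h = uncurry≤ (exch _ _ _ (curry≤ h))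

  comm⇒exchange : (∀ x y → (x · y) ≈ (y · x)) →
                  ∀ x y z → x ≤ (y ⇒ z) → y ≤ (x ⇒ z)
  comm⇒exchange comm x y z h = curry≤ (begin
    y · x  ≈⟨ comm y x ⟩
    x · y  ≤⟨ uncurry≤ h ⟩
    z      ∎)

  module _ (one : A) (top : IsGreatest P one) where

    ≥one⇒≈one : ∀ {x} → one ≤ x → x ≈ one
    ≥one⇒≈one one≤x = antisym (top _) one≤x

    leftUnit⇒orderByOne : (∀ x → (one · x) ≈ x) →
      ∀ x y → ((x ≤ y) → (x ⇒ y) ≈ one) × ((x ⇒ y) ≈ one → x ≤ y)
    leftUnit⇒orderByOne unitˡ x y = ≤⇒≈one , ≈one⇒≤
      where
      ≤⇒≈one : x ≤ y → (x ⇒ y) ≈ one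
      ≤⇒≈one x≤y = ≥one⇒≈one (curry≤ (trans (reflexive (unitˡ x)) x≤y))

      ≈one⇒≤ : (x ⇒ y) ≈ one → x ≤ y
      ≈one⇒≤ e = begin
        x        ≈⟨ Eq.sym (unitˡ x) ⟩
        one · x  ≤⟨ uncurry≤ (reflexive (Eq.sym e)) ⟩
        y        ∎

    orderByOne⇒leftUnit :
      (∀ x y → ((x ≤ y) → (x ⇒ y) ≈ one) × ((x ⇒ y) ≈ one → x ≤ y)) →
      ∀ x → (one · x) ≈ x
    orderByOne⇒leftUnit ord x with ord x x | ord x (one · x)
    ... | refl⇒≈one , _ | _ , ≈one⇒≤ =
      antisym (uncurry≤ (reflexive (Eq.sym (refl⇒≈one refl))))
              (≈one⇒≤ (≥one⇒≈one (unit one x)))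

    integral : (∀ x → (one · x) ≈ x) → ∀ x y → (x · y) ≤ y
    integral unitˡ x y = begin
      x · y    ≤⟨ ·-monoˡ y (top x) ⟩
      one · y  ≈⟨ unitˡ y ⟩
      y        ∎

  idempotent⇒weaklyContractive : IsIdempotent P _·_ → IsWeaklyContractive P _⇒_
  idempotent⇒weaklyContractive idem x y x≤x⇒y = begin
    x      ≈⟨ Eq.sym (idem x) ⟩
    x · x  ≤⟨ uncurry≤ x≤x⇒y ⟩
    y      ∎

  weaklyContractive⇒square≥ : IsWeaklyContractive P _⇒_ → ∀ x → x ≤ (x · x)
  weaklyContractive⇒square≥ wc x = wc x (x · x) (unit x x)

theorem4p3 : {c ℓ₁ ℓ₂ : Level} (P : Poset c ℓ₁ ℓ₂)
    (_·_ _⇒_ : Poset.Carrier P → Poset.Carrier P → Poset.Carrier P)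
    (one : Poset.Carrier P) →
    IsAdjunction P _·_ _⇒_ →
    (IsWBCK* P _⇒_ one ⇔ (IsCommGroupoidWithNeutral P _·_ one × IsGreatest P one))
    × (IsWBCK* P _⇒_ one → (IsWeaklyContractive P _⇒_ ⇔ IsIdempotent P _·_))
theorem4p3 P _·_ _⇒_ one adj = mk⇔ wbck⇒groupoid groupoid⇒wbck , contractive⇔idempotent
  where
  open Poset P using (_≈_; antisym; module Eq)
  open Adjunction P _·_ _⇒_ adj

  wbck⇒groupoid : IsWBCK* P _⇒_ one → IsCommGroupoidWithNeutral P _·_ one × IsGreatest P one
  wbck⇒groupoid (top , ord , exch) =
    (comm , λ x → unitˡ x , Eq.trans (comm x one) (unitˡ x)) , top
    where
    comm : ∀ x y → (x · y) ≈ (y · x)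
    comm = exchange⇒comm exch

    unitˡ : ∀ x → (one · x) ≈ x
    unitˡ = orderByOne⇒leftUnit one top ord

  groupoid⇒wbck : IsCommGroupoidWithNeutral P _·_ one × IsGreatest P one → IsWBCK* P _⇒_ one
  groupoid⇒wbck ((comm , neutral) , top) =
    top , leftUnit⇒orderByOne one top (λ x → proj₁ (neutral x)) , comm⇒exchange comm

  contractive⇔idempotent : IsWBCK* P _⇒_ one → IsWeaklyContractive P _⇒_ ⇔ IsIdempotent P _·_
  contractive⇔idempotent (top , ord , _) = mk⇔
    (λ wc x → antisym (integral one top (orderByOne⇒leftUnit one top ord) x x)
                      (weaklyContractive⇒square≥ wc x))
    idempotent⇒weaklyContractive
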